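{- Let $\mathscr S=\langle E,S,F,N,g,s\rangle$ be an abstract formal system, and let $A\subseteq F$ and $B\subseteq S$. Suppose that $\mathscr S$ is self-referential with respect to $B$ and that the set $N\setminus g^*A=\{n\in N: g^{ -1}(n)\notin A\}$ is $B$-representable. Then $S\cap A\neq B$.
   Context: An abstract formal system is a tuple $\mathscr S=\langle E,S,F,N,g,s\rangle$ such that: (i) $\emptyset\neq S\subseteq F\subseteq E$ and $N$ is a set with $F\cap N=\emptyset$; (ii) $g$ is a one-one map from $F$ onto $N$ (the naming function), with inverse $g^{ -1}$; for $H\subseteq F$, $g^*H=\{g(\varphi):\varphi\in H\}$; (iii) $s$ is a map from $F\times N$ into $S$ such that $s(\sigma,n)=\sigma$ for all $\sigma\in S$, $n\in N$; one writes $\varphi[n]$ for $s(\varphi,n)$. For $B\subseteq S$ and $X\subseteq N$, $X$ is $B$-representable if there is $\varphi\in F$ such that for every $n\in N$: $n\in X$ iff $\varphi[n]\in B$. $\mathscr S$ is self-referential with respect to $B$ if for every $X\subseteq N$ which is $B$-representable, the set $\{n\in N: g(g^{ -1}(n)[n])\in X\}$ is also $B$-representable. -}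

module Defs where

open import Level using (Level; _⊔_; suc)
open import Data.Product using (Σ; ∃; _×_; _,_)
open import Relation.Unary using (Pred; _⊆_; _∈_; _∉_)
open import Relation.Binary.PropositionalEquality using (_≡_)
open import Function.Bundles using (_↔_; _⇔_; Inverse)

-- N is a separate type of names (so F ∩ N = ∅ holds
-- by construction).  g is a bijection from the subtype of formulas onto N.
record AFS (a : Level) : Set (suc a) where
  field
    E   : Set a
    F   : Pred E a
    S   : Pred E a
    S⊆F : S ⊆ F
    S≠∅ : ∃ λ σ → σ ∈ S
    N   : Set a
  Form : Set a
  Form = Σ E F
  field
    g   : Form ↔ N
    sub     : Form → N → E
    sub∈S   : ∀ φ n → sub φ n ∈ S
    sub-sen : ∀ (σ : E) (σ∈S : σ ∈ S) (n : N) → sub (σ , S⊆F σ∈S) n ≡ σ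

  g⁻¹ : N → Form
  g⁻¹ = Inverse.from g

  gS : ∀ (e : E) → e ∈ S → N
  gS e e∈S = Inverse.to g (e , S⊆F e∈S)

  Representable : ∀ {ℓ ℓ'} → Pred E ℓ → Pred N ℓ' → Set (a ⊔ ℓ ⊔ ℓ')
  Representable B X = Σ Form λ φ → ∀ n → (X n ⇔ B (sub φ n))

  Diag : ∀ {ℓ'} → Pred N ℓ' → Pred N ℓ'
  Diag X n = X (gS (sub (g⁻¹ n) n) (sub∈S (g⁻¹ n) n))

  SelfReferential : ∀ ℓ → Pred E ℓ → Set (a ⊔ suc ℓ)
  SelfReferential ℓ B = ∀ (X : Pred N ℓ) → Representable B X → Representable B (Diag X)

-- The argument is the liar paradox.  Self-reference yields a diagonal
-- sentence σ asserting "σ ∉ A" in the sense that σ ∉ A ⇔ σ ∈ B.  If S ∩ A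
-- were B, then, σ being a sentence, also σ ∈ A ⇔ σ ∈ B, which is absurd.
module Submission where

open import Defs
open import Data.Product using (∃₂; _×_; _,_; proj₁; proj₂)
open import Relation.Unary using (Pred; _⊆_; _∈_; _∉_)
open import Relation.Nullary using (¬_)
open import Relation.Binary.PropositionalEquality using (_≡_; cong; sym; subst)
open import Function.Bundles using (_⇔_; mk⇔; Inverse; module Equivalence)
open import Function.Construct.Composition using (_⇔-∘_)

¬[¬P⇔P] : ∀ {p} {P : Set p} → ¬ ((¬ P) ⇔ P)
¬[¬P⇔P] {P = P} ¬P⇔P = ¬p (to ¬p)
  where
  open Equivalence ¬P⇔P
  ¬p : ¬ P
  ¬p p = from p p

module _ {a} (𝒮 : AFS a) where
  open AFS 𝒮

  g⁻¹-gS : ∀ e (e∈S : e ∈ S) → proj₁ (g⁻¹ (gS e e∈S)) ≡ e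
  g⁻¹-gS e e∈S = cong proj₁ (Inverse.strictlyInverseʳ g (e , S⊆F e∈S))

  diagonal : ∀ {ℓ} {B : Pred E ℓ} {X : Pred N ℓ} →
             SelfReferential ℓ B → Representable B X →
             ∃₂ λ σ (σ∈S : σ ∈ S) → X (gS σ σ∈S) ⇔ B σ
  diagonal {B = B} {X} selfRef X-rep = σ , σ∈S , subst (λ e → Diag X n ⇔ B e) ψ[n]≡σ (ψ-rep n)
    where
    -- ψ represents Diag X; instantiated at its own name, Diag X n is X (gS σ _) by definition.
    ψ = proj₁ (selfRef X X-rep)
    ψ-rep = proj₂ (selfRef X X-rep)
    n = Inverse.to g ψ
    σ = sub (g⁻¹ n) n
    σ∈S = sub∈S (g⁻¹ n) n
    ψ[n]≡σ : sub ψ n ≡ σ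
    ψ[n]≡σ = cong (λ φ → sub φ n) (sym (Inverse.strictlyInverseʳ g ψ))

  liarSentence : ∀ {ℓ} (A B : Pred E ℓ) →
                 SelfReferential ℓ B → Representable B (λ n → proj₁ (g⁻¹ n) ∉ A) →
                 ∃₂ λ σ (_ : σ ∈ S) → (σ ∉ A) ⇔ B σ
  liarSentence A B selfRef nonA-rep with diagonal selfRef nonA-rep
  ... | σ , σ∈S , fixed = σ , σ∈S , subst (_⇔ B σ) (cong (_∉ A) (g⁻¹-gS σ σ∈S)) fixed

mainTheorem2 : ∀ {a} (𝒮 : AFS a) → let open AFS 𝒮 in
    (A : Pred E a) → A ⊆ F → (B : Pred E a) → B ⊆ S →
    SelfReferential a B →
    Representable B (λ n → proj₁ (g⁻¹ n) ∉ A) →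
    ¬ (∀ (e : E) → ((e ∈ S × e ∈ A) ⇔ e ∈ B))
mainTheorem2 𝒮 A _ B _ selfRef nonA-rep S∩A≡B
  with liarSentence 𝒮 A B selfRef nonA-rep
... | σ , σ∈S , ¬A⇔B = ¬[¬P⇔P] (B⇔A ⇔-∘ ¬A⇔B)
  where
  open Equivalence (S∩A≡B σ)
  B⇔A : B σ ⇔ A σ
  B⇔A = mk⇔ (λ b → proj₂ (from b)) (λ σ∈A → to (σ∈S , σ∈A))
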